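{- For every nowhere dense set $C\subseteq 2^\omega$ and every $m\in\omega$ there exists $k\in\omega$ such that for every $\alpha\in 2^m$ and every $\beta\in 2^{m+k}$ there exists $\gamma\in 2^{m+k}$ with $\alpha\subseteq\gamma$ and $([\gamma]+[\beta])\cap C=\emptyset$.
   Context: $2^\omega$ is the Cantor space with coordinatewise addition modulo 2. For a finite binary sequence $\beta$, $[\beta]=\{x\in 2^\omega:\beta\subseteq x\}$; $2^m$ denotes the set of binary sequences of length $m$. For $A,B\subseteq 2^\omega$, $A+B=\{a+b:a\in A,b\in B\}$. -}

module Defs where

open import Data.Bool using (Bool; _xor_)
open import Data.Nat using (ℕ; _+_)
open import Data.Fin using (Fin; toℕ)
open import Data.Vec using (Vec; lookup; take)
open import Data.Product using (Σ; _×_)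
open import Relation.Binary.PropositionalEquality using (_≡_)
open import Relation.Nullary using (¬_)

Cantor : Set
Cantor = ℕ → Bool

_⊕_ : Cantor → Cantor → Cantor
(x ⊕ y) n = x n xor y n

_∈[_] : {n : ℕ} → Cantor → Vec Bool n → Set
x ∈[ β ] = ∀ i → x (toℕ i) ≡ lookup β i

_⊑_ : {m k : ℕ} → Vec Bool m → Vec Bool (m + k) → Set
_⊑_ {m} α γ = take m γ ≡ α

NowhereDense : (Cantor → Set) → Set
NowhereDense C =
  ∀ (n : ℕ) (σ : Vec Bool n) →
  Σ ℕ λ k → Σ (Vec Bool (n + k)) λ τ →
    (σ ⊑ τ) × (∀ x → x ∈[ τ ] → ¬ C x)

{-# OPTIONS --safe #-}
module Submission where

open import Defs
open import Data.Bool using (Bool; true; false; _xor_)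
open import Data.Bool.Properties using (xor-assoc; xor-same; xor-identityʳ)
open import Data.Nat using (ℕ; zero; suc; _+_; _≤_; _<_; _⊔_; s≤s; z≤n)
open import Data.Nat.Properties
  using (≤-refl; ≤-trans; <-≤-trans; m≤m⊔n; m≤n⊔m; m≤m+n; +-monoʳ-≤)
open import Data.Fin using (Fin; toℕ; fromℕ<) renaming (zero to fzero; suc to fsuc)
open import Data.Fin.Properties using (toℕ<n; toℕ-fromℕ<)
open import Data.Vec using (Vec; []; _∷_; lookup; take)
open import Data.Product using (Σ; _×_; _,_; proj₁; proj₂)
open import Relation.Nullary using (¬_)
open import Relation.Binary.PropositionalEquality
  using (_≡_; refl; sym; trans; cong; cong₂; module ≡-Reasoning)

-- Idea: let k bound the lengths of the extensions of the finitely many σ ∈ 2^m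
-- given by nowhere density. For α and β, apply nowhere density to σ = α + β|m,
-- obtaining τ ⊇ σ with [τ] ∩ C = ∅, and put γ = (τ + β)|(m+k), padding τ
-- with zeros. Since addition is its own inverse, γ|m = σ + β|m = α and
-- [γ] + [β] ⊆ [τ].

_≈[_]_ : Cantor → ℕ → Cantor → Set
x ≈[ n ] y = ∀ {j} → j < n → x j ≡ y j

≈-sym : ∀ {n x y} → x ≈[ n ] y → y ≈[ n ] x
≈-sym x≈y j<n = sym (x≈y j<n)

≈-trans : ∀ {n x y z} → x ≈[ n ] y → y ≈[ n ] z → x ≈[ n ] z
≈-trans x≈y y≈z j<n = trans (x≈y j<n) (y≈z j<n)

≈-weaken : ∀ {m n x y} → m ≤ n → x ≈[ n ] y → x ≈[ m ] y
≈-weaken m≤n x≈y j<m = x≈y (<-≤-trans j<m m≤n)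

⊕-cong-≈ : ∀ {n x x′ y y′} → x ≈[ n ] x′ → y ≈[ n ] y′ → (x ⊕ y) ≈[ n ] (x′ ⊕ y′)
⊕-cong-≈ x≈x′ y≈y′ j<n = cong₂ _xor_ (x≈x′ j<n) (y≈y′ j<n)

⊕-congʳ-≈ : ∀ {n x x′} y → x ≈[ n ] x′ → (x ⊕ y) ≈[ n ] (x′ ⊕ y)
⊕-congʳ-≈ y x≈x′ j<n = cong (_xor y _) (x≈x′ j<n)

⊕-cancelʳ : ∀ x y n → ((x ⊕ y) ⊕ y) n ≡ x n
⊕-cancelʳ x y n = begin
  (x n xor y n) xor y n   ≡⟨ xor-assoc (x n) (y n) (y n) ⟩
  x n xor (y n xor y n)   ≡⟨ cong (x n xor_) (xor-same (y n)) ⟩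
  x n xor false           ≡⟨ xor-identityʳ (x n) ⟩
  x n                     ∎
  where open ≡-Reasoning

extend : ∀ {n} → Vec Bool n → Cantor
extend []      _       = false
extend (b ∷ v) zero    = b
extend (b ∷ v) (suc j) = extend v j

prefix : (n : ℕ) → Cantor → Vec Bool n
prefix zero    x = []
prefix (suc n) x = x 0 ∷ prefix n (λ j → x (suc j))

extend-lookup : ∀ {n} (v : Vec Bool n) (i : Fin n) → extend v (toℕ i) ≡ lookup v i
extend-lookup (b ∷ v) fzero    = refl
extend-lookup (b ∷ v) (fsuc i) = extend-lookup v i

extend-prefix : ∀ n x → extend (prefix n x) ≈[ n ] x
extend-prefix (suc n) x {zero}  _         = refl
extend-prefix (suc n) x {suc j} (s≤s j<n) = extend-prefix n (λ j → x (suc j)) j<n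

extend-take : ∀ m {k} (v : Vec Bool (m + k)) → extend (take m v) ≈[ m ] extend v
extend-take (suc m) (b ∷ v) {zero}  _         = refl
extend-take (suc m) (b ∷ v) {suc j} (s≤s j<m) = extend-take m v j<m

extend-injective : ∀ {n} (v w : Vec Bool n) → extend v ≈[ n ] extend w → v ≡ w
extend-injective []      []      _   = refl
extend-injective (a ∷ v) (b ∷ w) v≈w =
  cong₂ _∷_ (v≈w (s≤s z≤n)) (extend-injective v w (λ j<n → v≈w (s≤s j<n)))

∈[]⇒≈extend : ∀ {n} x (v : Vec Bool n) → x ∈[ v ] → x ≈[ n ] extend v
∈[]⇒≈extend {n} x v x∈v {j} j<n = begin
  x j                           ≡⟨ cong x (sym (toℕ-fromℕ< j<n)) ⟩
  x (toℕ i)                     ≡⟨ x∈v i ⟩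
  lookup v i                    ≡⟨ sym (extend-lookup v i) ⟩
  extend v (toℕ i)              ≡⟨ cong (extend v) (toℕ-fromℕ< j<n) ⟩
  extend v j                    ∎
  where
  open ≡-Reasoning
  i : Fin n
  i = fromℕ< j<n

≈extend⇒∈[] : ∀ {n} x (v : Vec Bool n) → x ≈[ n ] extend v → x ∈[ v ]
≈extend⇒∈[] x v x≈v i = trans (x≈v (toℕ<n i)) (extend-lookup v i)

⊑⇒≈ : ∀ {m k} {α : Vec Bool m} {γ : Vec Bool (m + k)} → α ⊑ γ → extend γ ≈[ m ] extend α
⊑⇒≈ {m} {γ = γ} refl = ≈-sym (extend-take m γ)

≈⇒⊑ : ∀ {m k} (α : Vec Bool m) (γ : Vec Bool (m + k)) → extend γ ≈[ m ] extend α → α ⊑ γ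
≈⇒⊑ {m} α γ γ≈α = extend-injective (take m γ) α (≈-trans (extend-take m γ) γ≈α)

bounded : ∀ m (f : Vec Bool m → ℕ) → Σ ℕ λ K → ∀ v → f v ≤ K
bounded zero    f = f [] , λ { [] → ≤-refl }
bounded (suc m) f with bounded m (λ v → f (true ∷ v)) | bounded m (λ v → f (false ∷ v))
... | Kᵗ , f≤Kᵗ | Kᶠ , f≤Kᶠ = Kᵗ ⊔ Kᶠ , λ
  { (true  ∷ v) → ≤-trans (f≤Kᵗ v) (m≤m⊔n Kᵗ Kᶠ)
  ; (false ∷ v) → ≤-trans (f≤Kᶠ v) (m≤n⊔m Kᵗ Kᶠ)
  }

module TranslatedCylinder {m k K : ℕ} (k≤K : k ≤ K) (α : Vec Bool m) (β : Vec Bool (m + K))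
                          (τ : Vec Bool (m + k)) (σ⊑τ : prefix m (extend α ⊕ extend β) ⊑ τ) where

  σ : Vec Bool m
  σ = prefix m (extend α ⊕ extend β)

  γ : Vec Bool (m + K)
  γ = prefix (m + K) (extend τ ⊕ extend β)

  γ≈τ⊕β : extend γ ≈[ m + K ] (extend τ ⊕ extend β)
  γ≈τ⊕β = extend-prefix (m + K) (extend τ ⊕ extend β)

  α⊑γ : α ⊑ γ
  α⊑γ = ≈⇒⊑ α γ λ {j} j<m → begin
    extend γ j                                  ≡⟨ γ≈τ⊕β (<-≤-trans j<m (m≤m+n m K)) ⟩
    (extend τ ⊕ extend β) j                     ≡⟨ ⊕-congʳ-≈ (extend β) (⊑⇒≈ σ⊑τ) j<m ⟩
    (extend σ ⊕ extend β) j                     ≡⟨ ⊕-congʳ-≈ (extend β) (extend-prefix m _) j<m ⟩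
    ((extend α ⊕ extend β) ⊕ extend β) j        ≡⟨ ⊕-cancelʳ (extend α) (extend β) j ⟩
    extend α j                                  ∎
    where open ≡-Reasoning

  ⊕-cylinder : ∀ x y → x ∈[ γ ] → y ∈[ β ] → (x ⊕ y) ∈[ τ ]
  ⊕-cylinder x y x∈γ y∈β = ≈extend⇒∈[] (x ⊕ y) τ (≈-weaken (+-monoʳ-≤ m k≤K) x⊕y≈τ)
    where
    x⊕y≈τ : (x ⊕ y) ≈[ m + K ] extend τ
    x⊕y≈τ j<n = trans
      (⊕-cong-≈ (≈-trans (∈[]⇒≈extend x γ x∈γ) γ≈τ⊕β) (∈[]⇒≈extend y β y∈β) j<n)
      (⊕-cancelʳ (extend τ) (extend β) _)

mainTheorem8 : (C : Cantor → Set) → NowhereDense C → (m : ℕ) →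
    Σ ℕ λ k → (α : Vec Bool m) → (β : Vec Bool (m + k)) →
      Σ (Vec Bool (m + k)) λ γ →
        (α ⊑ γ) × (∀ x y → x ∈[ γ ] → y ∈[ β ] → ¬ C (x ⊕ y))
mainTheorem8 C nd m = K , witness
  where
  extensionLength : Vec Bool m → ℕ
  extensionLength σ = proj₁ (nd m σ)

  K : ℕ
  K = proj₁ (bounded m extensionLength)

  witness : (α : Vec Bool m) (β : Vec Bool (m + K)) →
    Σ (Vec Bool (m + K)) λ γ → (α ⊑ γ) × (∀ x y → x ∈[ γ ] → y ∈[ β ] → ¬ C (x ⊕ y))
  witness α β =
    let σ = prefix m (extend α ⊕ extend β)
        _ , τ , σ⊑τ , τ∩C≡∅ = nd m σ
        open TranslatedCylinder (proj₂ (bounded m extensionLength) σ) α β τ σ⊑τ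
          using (γ; α⊑γ; ⊕-cylinder)
    in γ , α⊑γ , λ x y x∈γ y∈β → τ∩C≡∅ (x ⊕ y) (⊕-cylinder x y x∈γ y∈β)
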